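{- Let $G$ be a finite graph with vertex set $V$ that is lefthanded with respect to a tree order $\leq$ on $V$, with vertices labeled by real numbers $0\leq p_v\leq 1$. For $S\subseteq V$ define \[ \Lambda(S):=\sum_{\substack{I\subseteq S\\ I\text{ independent in }G}}(-1)^{|I|}\prod_{v\in I}p_v . \] For $w\in V$ let $\bar D_w:=\{u\in V: u\leq w\}$, and for $U\subseteq V$ let $\mu(U)$ be the set of maximal elements of $U$ with respect to $\leq$. Then for every down-closed set $S\subseteq V$ (i.e. $u\leq s\in S$ implies $u\in S$), \[ \Lambda(S)=\prod_{w\in\mu(S)}\Lambda(\bar D_w). \]
   Context: A tree order is a partial order $\leq$ in which $w\lneq u$ and $w\lneq v$ imply that $u$ and $v$ are comparable. A graph $G$ is lefthanded with respect to a tree order $\leq$ on $V(G)$ if (1) $u\sim v$ implies $u\leq v$ or $v\leq u$, and (2) whenever $w\lneq u\lneq v$ and $v\sim w$, also $v\sim u$. The empty set is independent, and an empty product equals $1$. -}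

module Defs where

open import Level using (Level; _⊔_)
open import Data.Bool using (Bool; true; false; if_then_else_)
open import Data.Nat using (ℕ; zero; suc)
open import Data.Fin using (Fin)
open import Data.Fin.Properties using (all?; _≟_)
open import Data.Fin.Subset using (Subset; _∈_; _∉_; _⊆_; ∣_∣; inside; outside)
open import Data.Fin.Subset.Properties using (_∈?_; _⊆?_)
open import Data.Vec using (Vec; []; _∷_; tabulate)
open import Data.List using (List; []; _∷_; _++_; map; foldr; allFin; [_])
open import Data.Product using (_×_)
open import Data.Sum using (_⊎_)
open import Relation.Nullary using (Dec; does; ¬_; ¬?)
open import Relation.Nullary.Decidable using (_→-dec_; _×-dec_)
open import Relation.Binary using (Rel; Decidable; IsPartialOrder)
open import Relation.Binary.PropositionalEquality using (_≡_; _≢_)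
open import Algebra.Bundles using (CommutativeRing)

private variable a : Level

Strict : {n : ℕ} → Rel (Fin n) a → Rel (Fin n) a
Strict _≤_ u v = u ≤ v × u ≢ v

IsTreeOrder : {n : ℕ} → Rel (Fin n) a → Set a
IsTreeOrder {n = n} _≤_ =
  IsPartialOrder _≡_ _≤_ ×
  (∀ (w u v : Fin n) → Strict _≤_ w u → Strict _≤_ w v → (u ≤ v) ⊎ (v ≤ u))

IsSimpleGraph : {n : ℕ} → Rel (Fin n) a → Set a
IsSimpleGraph {n = n} _∼_ =
  (∀ (u v : Fin n) → u ∼ v → v ∼ u) × (∀ (u : Fin n) → ¬ (u ∼ u))

IsLefthanded : {n : ℕ} {b : Level} → Rel (Fin n) a → Rel (Fin n) b → Set (a ⊔ b)
IsLefthanded {n = n} _∼_ _≤_ =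
  (∀ (u v : Fin n) → u ∼ v → (u ≤ v) ⊎ (v ≤ u)) ×
  (∀ (w u v : Fin n) → Strict _≤_ w u → Strict _≤_ u v → v ∼ w → v ∼ u)

Independent : {n : ℕ} → Rel (Fin n) a → Subset n → Set a
Independent {n = n} _∼_ I = ∀ (u v : Fin n) → u ∈ I → v ∈ I → ¬ (u ∼ v)

independent? : {n : ℕ} {_∼_ : Rel (Fin n) a} → Decidable _∼_ →
               (I : Subset n) → Dec (Independent _∼_ I)
independent? ∼? I = all? λ u → all? λ v →
  (u ∈? I) →-dec ((v ∈? I) →-dec ¬? (∼? u v))

allSubsets : (n : ℕ) → List (Subset n)
allSubsets zero = [ [] ]
allSubsets (suc n) = map (inside ∷_) (allSubsets n) ++ map (outside ∷_) (allSubsets n)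

subsetOf : {n : ℕ} {P : Fin n → Set a} → (∀ u → Dec (P u)) → Subset n
subsetOf P? = tabulate (λ u → does (P? u))

downSet : {n : ℕ} {_≤_ : Rel (Fin n) a} → Decidable _≤_ → Fin n → Subset n
downSet ≤? w = subsetOf (λ u → ≤? u w)

IsMaximal : {n : ℕ} → Rel (Fin n) a → Subset n → Fin n → Set a
IsMaximal {n = n} _≤_ U w = w ∈ U × (∀ (u : Fin n) → u ∈ U → w ≤ u → u ≡ w)

isMaximal? : {n : ℕ} {_≤_ : Rel (Fin n) a} → Decidable _≤_ →
             (U : Subset n) (w : Fin n) → Dec (IsMaximal _≤_ U w)
isMaximal? ≤? U w = (w ∈? U) ×-dec all? λ u →
  (u ∈? U) →-dec ((≤? w u) →-dec (u ≟ w))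

maximalElements : {n : ℕ} {_≤_ : Rel (Fin n) a} → Decidable _≤_ → Subset n → Subset n
maximalElements ≤? U = subsetOf (isMaximal? ≤? U)

DownClosed : {n : ℕ} → Rel (Fin n) a → Subset n → Set a
DownClosed {n = n} _≤_ S = ∀ (u s : Fin n) → u ≤ s → s ∈ S → u ∈ S

module WithRing {c ℓ : Level} (R : CommutativeRing c ℓ) where
  open CommutativeRing R

  sign : ℕ → Carrier
  sign zero = 1#
  sign (suc k) = - sign k

  prodOver : {n : ℕ} → Subset n → (Fin n → Carrier) → Carrier
  prodOver {n} U f = foldr (λ v acc → (if does (v ∈? U) then f v else 1#) * acc) 1# (allFin n)

  Λ : {n : ℕ} {_∼_ : Rel (Fin n) a} → Decidable _∼_ → (Fin n → Carrier) → Subset n → Carrier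
  Λ {n = n} ∼? p S = foldr
    (λ I acc → (if does ((I ⊆? S) ×-dec independent? ∼? I)
                  then sign ∣ I ∣ * prodOver I p else 0#) + acc)
    0# (allSubsets n)

module Submission where

--  1. Deletion of the first vertex 0 of Fin (suc n): writing Λ⁺ for Λ of the
--     graph induced on the other vertices,
--        Λ(S) = Λ⁺(S∖0)                       if 0 ∉ S,
--        Λ(S) = Λ⁺(S∖0) − p₀ · Λ⁺(S ∖ N[0])   if 0 ∈ S.
--  2. From this recurrence, by induction on n, Λ is multiplicative on
--     separated sets: Λ(A ∪ B) = Λ(A) · Λ(B) when A and B are disjoint and
--     no edge joins them.
--  3. In a tree order two distinct maximal elements of S have no common lower
--     bound; as edges join comparable vertices, the down-sets D̄_w of distinct
--     maximal elements are separated.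
--  4. Every element of S lies below a maximal element (Noetherian induction),
--     so a down-closed S is the union of the D̄_w, w ∈ μ(S), and the theorem
--     follows from 2 and 3 by induction over the list of all vertices.

open import Defs
open import Level using (Level; _⊔_)
open import Data.Bool using (true; false; if_then_else_)
open import Data.Nat using (ℕ; zero; suc)
open import Data.Fin using (Fin; zero; suc)
open import Data.Fin.Properties using (_≟_; ¬∀⟶∃¬)
open import Data.Fin.Induction using (po-noetherian)
open import Data.Fin.Subset using (Subset; _∈_; _⊆_; ∣_∣; inside; outside; _∪_) renaming (⊥ to ∅)
open import Data.Fin.Subset.Properties
  using (_∈?_; _⊆?_; drop-∷-⊆; out⊆; in⊆in; ⊆-antisym; ∉⊥; x∈p∪q⁻; x∈p∪q⁺; ∪-comm)
open import Data.Vec using ([]; _∷_; here; there)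
open import Data.Vec.Properties using (lookup∘tabulate; []=⇒lookup; lookup⇒[]=)
open import Data.List using (List; []; _∷_; _++_; map; foldr; allFin)
open import Data.List.Properties using (foldr-map; map-tabulate)
open import Data.List.Membership.Propositional using (find; lose)
open import Data.List.Membership.Propositional.Properties using (∈-allFin)
open import Data.List.Relation.Unary.Any using (Any; here; there; any?)
open import Data.List.Relation.Unary.All using (All) renaming (lookup to All-lookup)
open import Data.List.Relation.Unary.AllPairs using ([]; _∷_)
open import Data.List.Relation.Unary.Unique.Propositional using (Unique)
open import Data.List.Relation.Unary.Unique.Propositional.Properties using (allFin⁺)
open import Data.Product using (_×_; _,_; proj₁; proj₂; ∃)
open import Data.Sum using (_⊎_; inj₁; inj₂; swap)
open import Data.Empty using (⊥; ⊥-elim)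
open import Function using (_∘_; id; flip)
open import Function.Bundles using (_⇔_; mk⇔; Equivalence)
open import Induction.WellFounded using (Acc; acc)
open import Relation.Nullary using (Dec; yes; no; does; ¬_; ¬?; contradiction)
open import Relation.Nullary.Decidable using (_×-dec_; _→-dec_; dec-true)
open import Relation.Binary using (Rel; Decidable; IsPartialOrder)
import Relation.Binary.Construct.NonStrictToStrict as ToStrict
open import Relation.Binary.PropositionalEquality
  using (_≡_; _≢_; refl; cong; cong₂; ≢-sym)
  renaming (sym to ≡-sym; trans to ≡-trans)
open import Algebra.Bundles using (CommutativeRing)

module _ {a n} {P : Fin n → Set a} (P? : ∀ u → Dec (P u)) where

  ∈-subsetOf⁺ : ∀ {u} → P u → u ∈ subsetOf P?
  ∈-subsetOf⁺ {u} pu = lookup⇒[]= u _ (≡-trans (lookup∘tabulate _ u) (dec-true (P? u) pu))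

  ∈-subsetOf⁻ : ∀ {u} → u ∈ subsetOf P? → P u
  ∈-subsetOf⁻ {u} u∈ = witness (P? u) (≡-trans (≡-sym (lookup∘tabulate _ u)) ([]=⇒lookup u∈))
    where
    witness : ∀ {A : Set a} (A? : Dec A) → does A? ≡ true → A
    witness (yes x) _ = x
    witness (no _) ()

Separated : ∀ {a n} → Rel (Fin n) a → Subset n → Subset n → Set a
Separated _∼_ A B = ∀ {u v} → u ∈ A → v ∈ B → u ≢ v × ¬ (u ∼ v) × ¬ (v ∼ u)

separated-sym : ∀ {a n} {_∼_ : Rel (Fin n) a} {A B} → Separated _∼_ A B → Separated _∼_ B A
separated-sym sep v∈B u∈A with sep u∈A v∈B
... | u≢v , ¬uv , ¬vu = ≢-sym u≢v , ¬vu , ¬uv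

separated-⊆ˡ : ∀ {a n} {_∼_ : Rel (Fin n) a} {A A′ B} → A′ ⊆ A → Separated _∼_ A B → Separated _∼_ A′ B
separated-⊆ˡ A′⊆A sep u∈A′ = sep (A′⊆A u∈A′)

module FirstVertex {a n} {_∼_ : Rel (Fin (suc n)) a} (∼? : Decidable _∼_) where

  _∼⁺_ : Rel (Fin n) a
  u ∼⁺ v = suc u ∼ suc v

  ∼⁺? : Decidable _∼⁺_
  ∼⁺? u v = ∼? (suc u) (suc v)

  NonNeighbour : Fin n → Set a
  NonNeighbour v = ¬ (zero ∼ suc v) × ¬ (suc v ∼ zero)

  nonNeighbour? : (S : Subset n) → ∀ v → Dec (v ∈ S × NonNeighbour v)
  nonNeighbour? S v = (v ∈? S) ×-dec (¬? (∼? zero (suc v)) ×-dec ¬? (∼? (suc v) zero))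

  nonNeighbours : Subset n → Subset n
  nonNeighbours S = subsetOf (nonNeighbour? S)

  nonNeighbours-⊆ : ∀ {S} → nonNeighbours S ⊆ S
  nonNeighbours-⊆ {S} v∈ = proj₁ (∈-subsetOf⁻ (nonNeighbour? S) v∈)

  outside-condition : ∀ {x S I} →
    (outside ∷ I ⊆ x ∷ S × Independent _∼_ (outside ∷ I)) ⇔ (I ⊆ S × Independent _∼⁺_ I)
  outside-condition = mk⇔
    (λ (I⊆S , ind) → drop-∷-⊆ I⊆S , λ u v u∈ v∈ → ind (suc u) (suc v) (there u∈) (there v∈))
    (λ (I⊆S , ind) → out⊆ I⊆S , independent ind)
    where
    independent : ∀ {I} → Independent _∼⁺_ I → Independent _∼_ (outside ∷ I)
    independent ind (suc u) (suc v) (there u∈) (there v∈) = ind u v u∈ v∈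

  -- Independent subsets of S containing 0 are 0 plus an independent subset
  -- of S ∖ N[0]; the converse direction needs 0 to carry no loop.
  inside-condition : (∀ u → ¬ (u ∼ u)) → ∀ {S I} →
    (inside ∷ I ⊆ inside ∷ S × Independent _∼_ (inside ∷ I)) ⇔ (I ⊆ nonNeighbours S × Independent _∼⁺_ I)
  inside-condition irr {S} {I} = mk⇔
    (λ (I⊆S , ind) →
      (λ {v} v∈ → ∈-subsetOf⁺ (nonNeighbour? S)
                    (drop-∷-⊆ I⊆S v∈ , ind zero (suc v) here (there v∈) , ind (suc v) zero (there v∈) here)) ,
      λ u v u∈ v∈ → ind (suc u) (suc v) (there u∈) (there v∈))
    (λ (I⊆N , ind) → in⊆in (nonNeighbours-⊆ ∘ I⊆N) ,
                     independent (proj₂ ∘ ∈-subsetOf⁻ (nonNeighbour? S) ∘ I⊆N) ind)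
    where
    independent : (∀ {v} → v ∈ I → NonNeighbour v) → Independent _∼⁺_ I → Independent _∼_ (inside ∷ I)
    independent nn ind zero zero here here = irr zero
    independent nn ind zero (suc v) here (there v∈) = proj₁ (nn v∈)
    independent nn ind (suc u) zero (there u∈) here = proj₂ (nn u∈)
    independent nn ind (suc u) (suc v) (there u∈) (there v∈) = ind u v u∈ v∈

  separated-tail : ∀ {x y A B} → Separated _∼_ (x ∷ A) (y ∷ B) → Separated _∼⁺_ A B
  separated-tail sep u∈A v∈B with sep (there u∈A) (there v∈B)
  ... | u≢v , ¬uv , ¬vu = (λ u≡v → u≢v (cong suc u≡v)) , ¬uv , ¬vu

  separated-nonNeighbour : ∀ {x A B} → Separated _∼_ (inside ∷ A) (x ∷ B) → ∀ {v} → v ∈ B → NonNeighbour v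
  separated-nonNeighbour sep v∈B with sep here (there v∈B)
  ... | _ , ¬0v , ¬v0 = ¬0v , ¬v0

  nonNeighbours-∪ : ∀ {A B} → (∀ {v} → v ∈ B → NonNeighbour v) →
                    nonNeighbours (A ∪ B) ≡ nonNeighbours A ∪ B
  nonNeighbours-∪ {A} {B} nn = ⊆-antisym to from
    where
    to : nonNeighbours (A ∪ B) ⊆ nonNeighbours A ∪ B
    to v∈ with ∈-subsetOf⁻ (nonNeighbour? (A ∪ B)) v∈
    ... | v∈A∪B , v-nn with x∈p∪q⁻ A B v∈A∪B
    ...   | inj₁ v∈A = x∈p∪q⁺ (inj₁ (∈-subsetOf⁺ (nonNeighbour? A) (v∈A , v-nn)))
    ...   | inj₂ v∈B = x∈p∪q⁺ (inj₂ v∈B)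
    from : nonNeighbours A ∪ B ⊆ nonNeighbours (A ∪ B)
    from v∈ with x∈p∪q⁻ (nonNeighbours A) B v∈
    ... | inj₁ v∈N = let (v∈A , v-nn) = ∈-subsetOf⁻ (nonNeighbour? A) v∈N
                     in ∈-subsetOf⁺ (nonNeighbour? (A ∪ B)) (x∈p∪q⁺ (inj₁ v∈A) , v-nn)
    ... | inj₂ v∈B = ∈-subsetOf⁺ (nonNeighbour? (A ∪ B)) (x∈p∪q⁺ (inj₂ v∈B) , nn v∈B)

module TreeOrder {b n} {_≤_ : Rel (Fin n) b} (≤? : Decidable _≤_) (tree : IsTreeOrder _≤_) where
  open IsPartialOrder (proj₁ tree) using () renaming (refl to ≤-refl; trans to ≤-trans)

  maximal-unique : ∀ {U v w w′} → IsMaximal _≤_ U w → IsMaximal _≤_ U w′ → v ≤ w → v ≤ w′ → w ≡ w′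
  maximal-unique {v = v} {w} {w′} (w∈U , w-max) (w′∈U , w′-max) v≤w v≤w′ with v ≟ w | v ≟ w′
  ... | yes refl | _ = ≡-sym (w-max w′ w′∈U v≤w′)
  ... | no _ | yes refl = w′-max w w∈U v≤w
  ... | no v≢w | no v≢w′ with proj₂ tree v w w′ (v≤w , v≢w) (v≤w′ , v≢w′)
  ...   | inj₁ w≤w′ = ≡-sym (w-max w′ w′∈U w≤w′)
  ...   | inj₂ w′≤w = w′-max w w∈U w′≤w

  larger-element : ∀ {U v} → v ∈ U → ¬ IsMaximal _≤_ U v → ∃ λ u → u ∈ U × v ≤ u × v ≢ u
  larger-element {U} {v} v∈U not-max
    with ¬∀⟶∃¬ n _ (λ u → (u ∈? U) →-dec ((≤? v u) →-dec (u ≟ v))) (λ max → not-max (v∈U , max))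
  ... | u , ¬bounded with u ∈? U | ≤? v u | u ≟ v
  ...   | yes u∈U | yes v≤u | no u≢v = u , u∈U , v≤u , ≢-sym u≢v
  ...   | no u∉U | _ | _ = contradiction (λ u∈U → contradiction u∈U u∉U) ¬bounded
  ...   | _ | no v≰u | _ = contradiction (λ _ v≤u → contradiction v≤u v≰u) ¬bounded
  ...   | _ | _ | yes u≡v = contradiction (λ _ _ → u≡v) ¬bounded

  -- Every element of U lies below a maximal element of U; by Noetherian
  -- induction, since every partial order on a finite set is Noetherian.
  maximal-above : ∀ {U v} → v ∈ U → ∃ λ w → IsMaximal _≤_ U w × v ≤ w
  maximal-above {U} {v} v∈U = go v∈U (po-noetherian (proj₁ tree) v)
    where
    go : ∀ {v} → v ∈ U → Acc (flip (ToStrict._<_ _≡_ _≤_)) v → ∃ λ w → IsMaximal _≤_ U w × v ≤ w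
    go {v} v∈U (acc larger) with isMaximal? ≤? U v
    ... | yes max = v , max , ≤-refl
    ... | no not-max with larger-element v∈U not-max
    ...   | u , u∈U , v≤u , v≢u with go u∈U (larger (v≤u , v≢u))
    ...     | w , max , u≤w = w , max , ≤-trans v≤u u≤w

module MaximalDownSets {a b n} {_∼_ : Rel (Fin n) a} {_≤_ : Rel (Fin n) b} (≤? : Decidable _≤_)
  (tree : IsTreeOrder _≤_) (comparable : ∀ u v → u ∼ v → u ≤ v ⊎ v ≤ u) (S : Subset n) where
  open IsPartialOrder (proj₁ tree) using () renaming (trans to ≤-trans)
  open TreeOrder ≤? tree

  M : Subset n
  M = maximalElements ≤? S

  isMaximal : ∀ {w} → w ∈ M → IsMaximal _≤_ S w
  isMaximal = ∈-subsetOf⁻ (isMaximal? ≤? S)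

  below? : (ws : List (Fin n)) → ∀ v → Dec (Any (λ w → w ∈ M × v ≤ w) ws)
  below? ws v = any? (λ w → (w ∈? M) ×-dec ≤? v w) ws

  Below : List (Fin n) → Subset n
  Below ws = subsetOf (below? ws)

  Below-[] : Below [] ≡ ∅
  Below-[] = ⊆-antisym (λ {v} v∈ → contradiction (∈-subsetOf⁻ (below? []) v∈) λ ()) (⊥-elim ∘ ∉⊥)

  Below-∷-∉ : ∀ {w ws} → ¬ (w ∈ M) → Below (w ∷ ws) ≡ Below ws
  Below-∷-∉ {w} {ws} w∉M = ⊆-antisym to (∈-subsetOf⁺ (below? (w ∷ ws)) ∘ there ∘ ∈-subsetOf⁻ (below? ws))
    where
    to : Below (w ∷ ws) ⊆ Below ws
    to v∈ with ∈-subsetOf⁻ (below? (w ∷ ws)) v∈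
    ... | here (w∈M , _) = contradiction w∈M w∉M
    ... | there below = ∈-subsetOf⁺ (below? ws) below

  Below-∷-∈ : ∀ {w ws} → w ∈ M → Below (w ∷ ws) ≡ downSet ≤? w ∪ Below ws
  Below-∷-∈ {w} {ws} w∈M = ⊆-antisym to from
    where
    to : Below (w ∷ ws) ⊆ downSet ≤? w ∪ Below ws
    to v∈ with ∈-subsetOf⁻ (below? (w ∷ ws)) v∈
    ... | here (_ , v≤w) = x∈p∪q⁺ (inj₁ (∈-subsetOf⁺ (λ u → ≤? u w) v≤w))
    ... | there below = x∈p∪q⁺ (inj₂ (∈-subsetOf⁺ (below? ws) below))
    from : downSet ≤? w ∪ Below ws ⊆ Below (w ∷ ws)
    from {v} v∈ with x∈p∪q⁻ (downSet ≤? w) (Below ws) v∈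
    ... | inj₁ v∈D = ∈-subsetOf⁺ (below? (w ∷ ws)) (here (w∈M , ∈-subsetOf⁻ (λ u → ≤? u w) v∈D))
    ... | inj₂ v∈B = ∈-subsetOf⁺ (below? (w ∷ ws)) (there (∈-subsetOf⁻ (below? ws) v∈B))

  -- The down-set of a maximal element w is separated from everything below
  -- the other maximal elements: a common lower bound, or an edge between
  -- comparable vertices, would put some vertex below two maximal elements.
  separated-below : ∀ {w ws} → w ∈ M → All (w ≢_) ws → Separated _∼_ (downSet ≤? w) (Below ws)
  separated-below {w} {ws} w∈M w∉ws {u} {v} u∈D v∈B with find (∈-subsetOf⁻ (below? ws) v∈B)
  ... | w′ , w′∈ws , w′∈M , v≤w′ =
    (λ { refl → apart u≤w v≤w′ }) , apart-comparable ∘ comparable u v , apart-comparable ∘ swap ∘ comparable v u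
    where
    u≤w : u ≤ w
    u≤w = ∈-subsetOf⁻ (λ x → ≤? x w) u∈D
    apart : ∀ {x} → x ≤ w → x ≤ w′ → ⊥
    apart x≤w x≤w′ = All-lookup w∉ws w′∈ws (maximal-unique (isMaximal w∈M) (isMaximal w′∈M) x≤w x≤w′)
    apart-comparable : u ≤ v ⊎ v ≤ u → ⊥
    apart-comparable (inj₁ u≤v) = apart u≤w (≤-trans u≤v v≤w′)
    apart-comparable (inj₂ v≤u) = apart (≤-trans v≤u u≤w) v≤w′

  downClosed-Below : DownClosed _≤_ S → S ≡ Below (allFin n)
  downClosed-Below downClosed = ⊆-antisym to from
    where
    to : S ⊆ Below (allFin n)
    to v∈S with maximal-above v∈S
    ... | w , max , v≤w =
      ∈-subsetOf⁺ (below? (allFin n)) (lose (∈-allFin w) (∈-subsetOf⁺ (isMaximal? ≤? S) max , v≤w))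
    from : Below (allFin n) ⊆ S
    from {v} v∈ with find (∈-subsetOf⁻ (below? (allFin n)) v∈)
    ... | w , _ , w∈M , v≤w = downClosed v w v≤w (proj₁ (isMaximal w∈M))

module ProductFormula {c ℓ} (R : CommutativeRing c ℓ) where
  open CommutativeRing R
    using (Carrier; _≈_; _+_; _*_; -_; 0#; 1#; setoid; ring; +-cong; *-cong; +-assoc; +-comm;
           *-assoc; *-comm; +-identityˡ; +-identityʳ; *-identityˡ; distribˡ; distribʳ; zeroʳ; -‿cong;
           *-commutativeSemigroup)
    renaming (refl to ≈-refl; sym to ≈-sym; trans to ≈-trans; reflexive to ≈-reflexive)
  open import Algebra.Properties.Ring ring using (-‿distribˡ-*)
  open import Algebra.Properties.CommutativeSemigroup *-commutativeSemigroup using (x∙yz≈y∙xz)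
  open import Relation.Binary.Reasoning.Setoid setoid
  open WithRing R

  sumList : ∀ {x} {X : Set x} → (X → Carrier) → List X → Carrier
  sumList f = foldr (λ x rest → f x + rest) 0#

  module _ {x} {X : Set x} where

    sumList-++ : ∀ (f : X → Carrier) xs ys → sumList f (xs ++ ys) ≈ sumList f xs + sumList f ys
    sumList-++ f [] ys = ≈-sym (+-identityˡ _)
    sumList-++ f (x ∷ xs) ys = ≈-trans (+-cong ≈-refl (sumList-++ f xs ys)) (≈-sym (+-assoc _ _ _))

    sumList-cong : ∀ {f g : X → Carrier} → (∀ x → f x ≈ g x) → ∀ xs → sumList f xs ≈ sumList g xs
    sumList-cong f≈g [] = ≈-refl
    sumList-cong f≈g (x ∷ xs) = +-cong (f≈g x) (sumList-cong f≈g xs)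

    sumList-*ˡ : ∀ k (f : X → Carrier) xs → sumList (λ x → k * f x) xs ≈ k * sumList f xs
    sumList-*ˡ k f [] = ≈-sym (zeroʳ k)
    sumList-*ˡ k f (x ∷ xs) = ≈-trans (+-cong ≈-refl (sumList-*ˡ k f xs)) (≈-sym (distribˡ k _ _))

    sumList-zero : ∀ xs → sumList (λ (_ : X) → 0#) xs ≈ 0#
    sumList-zero [] = ≈-refl
    sumList-zero (x ∷ xs) = ≈-trans (+-identityˡ _) (sumList-zero xs)

  sumSubsets-suc : ∀ n (f : Subset (suc n) → Carrier) →
    sumList f (allSubsets (suc n))
      ≈ sumList (f ∘ (inside ∷_)) (allSubsets n) + sumList (f ∘ (outside ∷_)) (allSubsets n)
  sumSubsets-suc n f = begin
    sumList f (map (inside ∷_) Ls ++ map (outside ∷_) Ls)       ≈⟨ sumList-++ f (map (inside ∷_) Ls) _ ⟩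
    sumList f (map (inside ∷_) Ls) + sumList f (map (outside ∷_) Ls)
      ≡⟨ cong₂ _+_ (foldr-map _ (inside ∷_) 0# Ls) (foldr-map _ (outside ∷_) 0# Ls) ⟩
    sumList (f ∘ (inside ∷_)) Ls + sumList (f ∘ (outside ∷_)) Ls ∎
    where Ls = allSubsets n

  prodOver-∷ : ∀ {n} x (I : Subset n) f →
    prodOver (x ∷ I) f ≡ (if does (zero ∈? x ∷ I) then f zero else 1#) * prodOver I (f ∘ suc)
  prodOver-∷ {n} x I f =
    cong (factor zero) (≡-trans (cong (foldr factor 1#) (≡-sym (map-tabulate id suc)))
                                (foldr-map factor suc 1# (allFin n)))
    where
    factor : Fin (suc n) → Carrier → Carrier
    factor v rest = (if does (v ∈? x ∷ I) then f v else 1#) * rest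

  guard-cong : ∀ {p q} {P : Set p} {Q : Set q} (P? : Dec P) (Q? : Dec Q) → P ⇔ Q → ∀ {x y} → x ≈ y →
               (if does P? then x else 0#) ≈ (if does Q? then y else 0#)
  guard-cong (yes _) (yes _) _ x≈y = x≈y
  guard-cong (yes p) (no ¬q) P⇔Q _ = contradiction (Equivalence.to P⇔Q p) ¬q
  guard-cong (no ¬p) (yes q) P⇔Q _ = contradiction (Equivalence.from P⇔Q q) ¬p
  guard-cong (no _) (no _) _ _ = ≈-refl

  guard-false : ∀ {p} {P : Set p} (P? : Dec P) → ¬ P → ∀ {x} → (if does P? then x else 0#) ≈ 0#
  guard-false (yes p) ¬p = contradiction p ¬p
  guard-false (no _) _ = ≈-refl

  guard-true : ∀ {p} {P : Set p} (P? : Dec P) → P → ∀ {x} → (if does P? then x else 0#) ≈ x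
  guard-true (yes _) _ = ≈-refl
  guard-true (no ¬p) p = contradiction p ¬p

  guard-*ˡ : ∀ b k x → (if b then k * x else 0#) ≈ k * (if b then x else 0#)
  guard-*ˡ true k x = ≈-refl
  guard-*ˡ false k x = ≈-sym (zeroʳ k)

  -- the summand of Λ(S) at I; by definition Λ ∼? p S = sumList (term ∼? p S) (allSubsets n)
  term : ∀ {a n} {_∼_ : Rel (Fin n) a} → Decidable _∼_ → (Fin n → Carrier) → Subset n → Subset n → Carrier
  term ∼? p S I = if does ((I ⊆? S) ×-dec independent? ∼? I) then sign ∣ I ∣ * prodOver I p else 0#

  neg-exchange : ∀ s p₀ q → (- s) * (p₀ * q) ≈ (- p₀) * (s * q)
  neg-exchange s p₀ q = begin
    (- s) * (p₀ * q) ≈⟨ ≈-sym (-‿distribˡ-* s (p₀ * q)) ⟩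
    - (s * (p₀ * q)) ≈⟨ -‿cong (x∙yz≈y∙xz s p₀ q) ⟩
    - (p₀ * (s * q)) ≈⟨ -‿distribˡ-* p₀ (s * q) ⟩
    (- p₀) * (s * q) ∎

  module _ {a n} {_∼_ : Rel (Fin (suc n)) a} (∼? : Decidable _∼_) where
    open FirstVertex ∼?

    term-outside : ∀ p x S I → term ∼? p (x ∷ S) (outside ∷ I) ≈ term ∼⁺? (p ∘ suc) S I
    term-outside p x S I =
      guard-cong ((outside ∷ I ⊆? x ∷ S) ×-dec independent? ∼? (outside ∷ I)) ((I ⊆? S) ×-dec independent? ∼⁺? I)
        outside-condition
        (*-cong ≈-refl (≈-trans (≈-reflexive (prodOver-∷ outside I p)) (*-identityˡ _)))

    term-inside-outside : ∀ p S I → term ∼? p (outside ∷ S) (inside ∷ I) ≈ 0#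
    term-inside-outside p S I = guard-false ((inside ∷ I ⊆? outside ∷ S) ×-dec independent? ∼? (inside ∷ I))
        (λ { (I⊆S , _) → not-here (I⊆S here) }) {sign ∣ inside ∷ I ∣ * prodOver (inside ∷ I) p}
      where
      not-here : ¬ (zero ∈ outside ∷ S)
      not-here ()

    term-inside-inside : (∀ u → ¬ (u ∼ u)) → ∀ p S I →
      term ∼? p (inside ∷ S) (inside ∷ I) ≈ (- p zero) * term ∼⁺? (p ∘ suc) (nonNeighbours S) I
    term-inside-inside irr p S I = ≈-trans
      (guard-cong ((inside ∷ I ⊆? inside ∷ S) ×-dec independent? ∼? (inside ∷ I))
                  ((I ⊆? nonNeighbours S) ×-dec independent? ∼⁺? I) (inside-condition irr)
        (≈-trans (*-cong ≈-refl (≈-reflexive (prodOver-∷ inside I p))) (neg-exchange _ _ _)))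
      (guard-*ˡ (does ((I ⊆? nonNeighbours S) ×-dec independent? ∼⁺? I)) _ _)

    Λ-outside : ∀ p S → Λ ∼? p (outside ∷ S) ≈ Λ ∼⁺? (p ∘ suc) S
    Λ-outside p S = begin
      Λ ∼? p (outside ∷ S)                      ≈⟨ sumSubsets-suc n (term ∼? p (outside ∷ S)) ⟩
      sumList (term ∼? p (outside ∷ S) ∘ (inside ∷_)) Ls + sumList (term ∼? p (outside ∷ S) ∘ (outside ∷_)) Ls
        ≈⟨ +-cong (≈-trans (sumList-cong (term-inside-outside p S) Ls) (sumList-zero Ls))
                  (sumList-cong (term-outside p outside S) Ls) ⟩
      0# + Λ ∼⁺? (p ∘ suc) S                    ≈⟨ +-identityˡ _ ⟩
      Λ ∼⁺? (p ∘ suc) S                         ∎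
      where Ls = allSubsets n

    Λ-inside : (∀ u → ¬ (u ∼ u)) → ∀ p S →
      Λ ∼? p (inside ∷ S) ≈ Λ ∼⁺? (p ∘ suc) S + (- p zero) * Λ ∼⁺? (p ∘ suc) (nonNeighbours S)
    Λ-inside irr p S = begin
      Λ ∼? p (inside ∷ S)                       ≈⟨ sumSubsets-suc n (term ∼? p (inside ∷ S)) ⟩
      sumList (term ∼? p (inside ∷ S) ∘ (inside ∷_)) Ls + sumList (term ∼? p (inside ∷ S) ∘ (outside ∷_)) Ls
        ≈⟨ +-cong (≈-trans (sumList-cong (term-inside-inside irr p S) Ls)
                           (sumList-*ˡ (- p zero) (term ∼⁺? (p ∘ suc) (nonNeighbours S)) Ls))
                  (sumList-cong (term-outside p inside S) Ls) ⟩
      (- p zero) * Λ ∼⁺? (p ∘ suc) (nonNeighbours S) + Λ ∼⁺? (p ∘ suc) S ≈⟨ +-comm _ _ ⟩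
      Λ ∼⁺? (p ∘ suc) S + (- p zero) * Λ ∼⁺? (p ∘ suc) (nonNeighbours S) ∎
      where Ls = allSubsets n

  -- Λ(∅) = 1: only the empty set contributes.
  Λ-∅ : ∀ {a} n {_∼_ : Rel (Fin n) a} (∼? : Decidable _∼_) p → Λ ∼? p ∅ ≈ 1#
  Λ-∅ zero ∼? p = begin
    term ∼? p [] [] + 0#  ≈⟨ +-identityʳ _ ⟩
    term ∼? p [] []       ≈⟨ guard-true (([] ⊆? []) ×-dec independent? ∼? []) ((λ ()) , λ ()) ⟩
    1# * 1#               ≈⟨ *-identityˡ 1# ⟩
    1#                    ∎
  Λ-∅ (suc n) ∼? p = ≈-trans (Λ-outside ∼? p ∅) (Λ-∅ n (FirstVertex.∼⁺? ∼?) (p ∘ suc))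

  Multiplicative : ∀ {a n} {_∼_ : Rel (Fin n) a} → Decidable _∼_ → (Fin n → Carrier) → Set (a ⊔ ℓ)
  Multiplicative {_∼_ = _∼_} ∼? p = ∀ {A B} → Separated _∼_ A B → Λ ∼? p (A ∪ B) ≈ Λ ∼? p A * Λ ∼? p B

  factorʳ : ∀ x y z k → x * z + k * (y * z) ≈ (x + k * y) * z
  factorʳ x y z k = ≈-sym (≈-trans (distribʳ z x (k * y)) (+-cong ≈-refl (*-assoc k y z)))

  module _ {a n} {_∼_ : Rel (Fin (suc n)) a} (∼? : Decidable _∼_) (irr : ∀ u → ¬ (u ∼ u))
           {p : Fin (suc n) → Carrier} (mult⁺ : Multiplicative (FirstVertex.∼⁺? ∼?) (p ∘ suc)) where
    open FirstVertex ∼?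

    Λ⁺ : Subset n → Carrier
    Λ⁺ = Λ ∼⁺? (p ∘ suc)

    -- When 0 ∈ A, the non-neighbours of 0 in A ∪ B are those in A together with B.
    multiplicative-inside-outside : ∀ {A B} → Separated _∼_ (inside ∷ A) (outside ∷ B) →
      Λ ∼? p (inside ∷ (A ∪ B)) ≈ Λ ∼? p (inside ∷ A) * Λ ∼? p (outside ∷ B)
    multiplicative-inside-outside {A} {B} sep = begin
      Λ ∼? p (inside ∷ (A ∪ B))                       ≈⟨ Λ-inside ∼? irr p (A ∪ B) ⟩
      Λ⁺ (A ∪ B) + k * Λ⁺ (nonNeighbours (A ∪ B))
        ≡⟨ cong (λ N → Λ⁺ (A ∪ B) + k * Λ⁺ N) (nonNeighbours-∪ (separated-nonNeighbour sep)) ⟩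
      Λ⁺ (A ∪ B) + k * Λ⁺ (nonNeighbours A ∪ B)
        ≈⟨ +-cong (mult⁺ sep⁺) (*-cong ≈-refl (mult⁺ (separated-⊆ˡ nonNeighbours-⊆ sep⁺))) ⟩
      Λ⁺ A * Λ⁺ B + k * (Λ⁺ (nonNeighbours A) * Λ⁺ B)  ≈⟨ factorʳ _ _ _ _ ⟩
      (Λ⁺ A + k * Λ⁺ (nonNeighbours A)) * Λ⁺ B        ≈⟨ ≈-sym (*-cong (Λ-inside ∼? irr p A) (Λ-outside ∼? p B)) ⟩
      Λ ∼? p (inside ∷ A) * Λ ∼? p (outside ∷ B)      ∎
      where
      k = - p zero
      sep⁺ = separated-tail sep

    multiplicative-step : Multiplicative ∼? p
    multiplicative-step {inside ∷ A} {inside ∷ B} sep = ⊥-elim (proj₁ (sep here here) refl)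
    multiplicative-step {inside ∷ A} {outside ∷ B} sep = multiplicative-inside-outside sep
    multiplicative-step {outside ∷ A} {inside ∷ B} sep = begin
      Λ ∼? p (inside ∷ (A ∪ B))                   ≡⟨ cong (λ X → Λ ∼? p (inside ∷ X)) (∪-comm A B) ⟩
      Λ ∼? p (inside ∷ (B ∪ A))                   ≈⟨ multiplicative-inside-outside (separated-sym sep) ⟩
      Λ ∼? p (inside ∷ B) * Λ ∼? p (outside ∷ A)  ≈⟨ *-comm _ _ ⟩
      Λ ∼? p (outside ∷ A) * Λ ∼? p (inside ∷ B)  ∎
    multiplicative-step {outside ∷ A} {outside ∷ B} sep = begin
      Λ ∼? p (outside ∷ (A ∪ B))                   ≈⟨ Λ-outside ∼? p (A ∪ B) ⟩
      Λ⁺ (A ∪ B)                                   ≈⟨ mult⁺ (separated-tail sep) ⟩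
      Λ⁺ A * Λ⁺ B                                  ≈⟨ ≈-sym (*-cong (Λ-outside ∼? p A) (Λ-outside ∼? p B)) ⟩
      Λ ∼? p (outside ∷ A) * Λ ∼? p (outside ∷ B)  ∎

  Λ-multiplicative : ∀ {a} n {_∼_ : Rel (Fin n) a} (∼? : Decidable _∼_) → (∀ u → ¬ (u ∼ u)) → ∀ p →
                     Multiplicative ∼? p
  Λ-multiplicative zero ∼? irr p {[]} {[]} _ = ≈-trans Λ[]≈1 (≈-sym (≈-trans (*-cong Λ[]≈1 Λ[]≈1) (*-identityˡ 1#)))
    where Λ[]≈1 = Λ-∅ zero ∼? p
  Λ-multiplicative (suc n) ∼? irr p =
    multiplicative-step ∼? irr (Λ-multiplicative n (FirstVertex.∼⁺? ∼?) (irr ∘ suc) (p ∘ suc))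

  module _ {a b n} {_∼_ : Rel (Fin n) a} (∼? : Decidable _∼_) (irr : ∀ u → ¬ (u ∼ u))
           {_≤_ : Rel (Fin n) b} (≤? : Decidable _≤_) (tree : IsTreeOrder _≤_)
           (comparable : ∀ u v → u ∼ v → u ≤ v ⊎ v ≤ u) (p : Fin n → Carrier) (S : Subset n) where
    open MaximalDownSets ≤? tree comparable S

    -- ∏_{w ∈ ws ∩ μ(S)} Λ(D̄_w); for ws = allFin n this is the right-hand side of the theorem
    ∏Λ-down : List (Fin n) → Carrier
    ∏Λ-down = foldr (λ w rest → (if does (w ∈? M) then Λ ∼? p (downSet ≤? w) else 1#) * rest) 1#

    Λ-Below : ∀ {ws} → Unique ws → Λ ∼? p (Below ws) ≈ ∏Λ-down ws
    Λ-Below {[]} [] = ≈-trans (≈-reflexive (cong (Λ ∼? p) Below-[])) (Λ-∅ n ∼? p)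
    Λ-Below {w ∷ ws} (w∉ws ∷ unique) = by-cases (w ∈? M)
      where
      -- split on w ∈ μ(S) without abstracting over the membership test inside Below
      by-cases : (w∈M? : Dec (w ∈ M)) →
        Λ ∼? p (Below (w ∷ ws)) ≈ (if does w∈M? then Λ ∼? p (downSet ≤? w) else 1#) * ∏Λ-down ws
      by-cases (yes w∈M) = begin
        Λ ∼? p (Below (w ∷ ws))                      ≡⟨ cong (Λ ∼? p) (Below-∷-∈ {w} {ws} w∈M) ⟩
        Λ ∼? p (downSet ≤? w ∪ Below ws)             ≈⟨ Λ-multiplicative n ∼? irr p (separated-below w∈M w∉ws) ⟩
        Λ ∼? p (downSet ≤? w) * Λ ∼? p (Below ws)    ≈⟨ *-cong ≈-refl (Λ-Below {ws} unique) ⟩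
        Λ ∼? p (downSet ≤? w) * ∏Λ-down ws           ∎
      by-cases (no w∉M) = begin
        Λ ∼? p (Below (w ∷ ws))                      ≡⟨ cong (Λ ∼? p) (Below-∷-∉ {w} {ws} w∉M) ⟩
        Λ ∼? p (Below ws)                            ≈⟨ Λ-Below {ws} unique ⟩
        ∏Λ-down ws                                   ≈⟨ ≈-sym (*-identityˡ _) ⟩
        1# * ∏Λ-down ws                              ∎

-- Only irreflexivity of the graph and the first lefthandedness condition
-- (adjacent vertices are comparable) are used.
mainTheorem5 : {c ℓ a b : Level} (R : CommutativeRing c ℓ) (n : ℕ)
    (_∼_ : Rel (Fin n) a) (∼? : Decidable _∼_)
    (_≤_ : Rel (Fin n) b) (≤? : Decidable _≤_) →
    IsSimpleGraph _∼_ → IsTreeOrder _≤_ → IsLefthanded _∼_ _≤_ →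
    (p : Fin n → CommutativeRing.Carrier R) →
    (S : Subset n) → DownClosed _≤_ S →
    CommutativeRing._≈_ R
      (WithRing.Λ R ∼? p S)
      (WithRing.prodOver R (maximalElements ≤? S) (λ w → WithRing.Λ R ∼? p (downSet ≤? w)))
mainTheorem5 R n _∼_ ∼? _≤_ ≤? (_ , irreflexive) tree (comparable , _) p S downClosed = begin
  Λ ∼? p S                   ≡⟨ cong (Λ ∼? p) (downClosed-Below downClosed) ⟩
  Λ ∼? p (Below (allFin n))  ≈⟨ Λ-Below ∼? irreflexive ≤? tree comparable p S (allFin⁺ n) ⟩
  prodOver (maximalElements ≤? S) (λ w → Λ ∼? p (downSet ≤? w)) ∎
  where
  open ProductFormula R
  open WithRing R
  open MaximalDownSets ≤? tree comparable S
  open import Relation.Binary.Reasoning.Setoid (CommutativeRing.setoid R)
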